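{- Let $T_v$ be a colored rooted ternary tree with root $v$ having three children $w,u,z$, with root vectors $\mathbf{v},\mathbf{w},\mathbf{u},\mathbf{z}$ of $T_v,T_w,T_u,T_z$. If $\mathbf{w}\geq\mathbf{e}^w=(\varphi^{e^w_s})_{s=0,\dots,3}$, $\mathbf{u}\geq\mathbf{e}^u=(\varphi^{e^u_s})_{s=0,\dots,3}$ and $\mathbf{z}\geq\mathbf{e}^z=(\varphi^{e^z_s})_{s=0,\dots,3}$ with all exponents in $\mathbb{N}$, then there are $e_0,\dots,e_3\in\mathbb{N}$ such that $\mathbf{v}\geq\mathbf{e}=(\varphi^{e_s})_{s=0,\dots,3}$ and $\Psi(\mathbf{e})=\Psi(\mathbf{e}^w)+\Psi(\mathbf{e}^u)+\Psi(\mathbf{e}^z)$.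
   Context: For a vertex $x$, $T_x$ is the subtree of $x$ and its descendants. $\varphi=(1+\sqrt5)/2$, $\mathbb{N}=\{0,1,2,\dots\}$, $\Psi(\mathbf{e})=2(e_1+e_2+e_3)$ for $\mathbf{e}=(\varphi^{e_s})_{s=0,\dots,3}$; $\geq$ between vectors is componentwise. A colored rooted ternary tree is a rooted tree in which every vertex has at most three children, every non-root vertex $x$ has a label $l_x\in\{1,2,3\}$, and children of a common vertex have distinct labels. Its root vector is defined recursively; for a vertex $x$ let $\mathbf{x}=(x_0,x_1,x_2,x_3)$ denote the root vector of $T_x$. For the root $v$: Rule 0: no children gives $\mathbf{v}=(1,1,1,1)$. Rule 1: exactly one child $a$ gives $\mathbf{v}=(a_1,a_0+a_1,a_3,a_2)$, $(a_1,a_3,a_2,a_0+a_1)$ or $(a_1,a_2,a_0+a_1,a_3)$ according as $l_a=1,2,3$. Rule 2: for exactly two children named $a,b$ with $(l_a,l_b)\in\{(1,2),(2,3),(3,1)\}$: $\mathbf{v}=(a_1b_1,a_0b_2+a_1b_3,a_3b_2,a_2b_1+a_3b_0)$ if $l_a=1$; $(a_1b_1,a_3b_2,a_3b_0+a_2b_1,a_1b_3+a_0b_2)$ if $l_a=2$; $(a_1b_1,a_3b_0+a_2b_1,a_0b_2+a_1b_3,a_3b_2)$ if $l_a=3$. Rule 3: three children $a,b,c$ labeled $1,2,3$ give $\mathbf{v}=(a_0b_0c_0+a_1b_1c_1,a_0b_2c_3+a_1b_3c_2,a_2b_3c_0+a_3b_2c_1,a_2b_1c_3+a_3b_0c_2)$.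 -}

module Defs where

open import Data.Nat using (ℕ; zero; suc; _+_; _*_; _∸_; _≤_)
open import Data.Maybe using (Maybe; just; nothing)
open import Data.Product using (_×_)

record V4 : Set where
  constructor ⟨_,_,_,_⟩
  field
    c0 c1 c2 c3 : ℕ
open V4 public

-- Colored rooted ternary tree: a vertex has an optional child of each
-- label 1, 2, 3 (children of a common vertex have distinct labels).
data Tree : Set where
  node : (ch1 ch2 ch3 : Maybe Tree) → Tree

rootVec : Tree → V4
rootVec (node nothing nothing nothing) = ⟨ 1 , 1 , 1 , 1 ⟩
rootVec (node (just t) nothing nothing) =
  let a = rootVec t in ⟨ c1 a , c0 a + c1 a , c3 a , c2 a ⟩
rootVec (node nothing (just t) nothing) =
  let a = rootVec t in ⟨ c1 a , c3 a , c2 a , c0 a + c1 a ⟩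
rootVec (node nothing nothing (just t)) =
  let a = rootVec t in ⟨ c1 a , c2 a , c0 a + c1 a , c3 a ⟩
rootVec (node (just ta) (just tb) nothing) =
  let a = rootVec ta ; b = rootVec tb in
  ⟨ c1 a * c1 b , c0 a * c2 b + c1 a * c3 b , c3 a * c2 b , c2 a * c1 b + c3 a * c0 b ⟩
rootVec (node nothing (just ta) (just tb)) =
  let a = rootVec ta ; b = rootVec tb in
  ⟨ c1 a * c1 b , c3 a * c2 b , c3 a * c0 b + c2 a * c1 b , c1 a * c3 b + c0 a * c2 b ⟩
rootVec (node (just tb) nothing (just ta)) =
  let a = rootVec ta ; b = rootVec tb in
  ⟨ c1 a * c1 b , c3 a * c0 b + c2 a * c1 b , c0 a * c2 b + c1 a * c3 b , c3 a * c2 b ⟩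
rootVec (node (just ta) (just tb) (just tc)) =
  let a = rootVec ta ; b = rootVec tb ; c = rootVec tc in
  ⟨ c0 a * c0 b * c0 c + c1 a * c1 b * c1 c
  , c0 a * c2 b * c3 c + c1 a * c3 b * c2 c
  , c2 a * c3 b * c0 c + c3 a * c2 b * c1 c
  , c2 a * c1 b * c3 c + c3 a * c0 b * c2 c ⟩

-- Fibonacci and Lucas numbers; φ^e = (L e + F e · √5) / 2 exactly.
fib : ℕ → ℕ
fib 0 = 0
fib 1 = 1
fib (suc (suc n)) = fib (suc n) + fib n

lucas : ℕ → ℕ
lucas 0 = 2
lucas 1 = 1
lucas (suc (suc n)) = lucas (suc n) + lucas n

-- φ^e ≤ x  (x ∈ ℕ), decided exactly:
-- (L_e + F_e √5)/2 ≤ x  ⇔  L_e ≤ 2x  ∧  5 F_e² ≤ (2x − L_e)².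
φ^_≤_ : ℕ → ℕ → Set
φ^ e ≤ x = (lucas e ≤ 2 * x) × (5 * (fib e * fib e) ≤ (2 * x ∸ lucas e) * (2 * x ∸ lucas e))

-- v ≥ e = (φ^{e_s})_{s=0..3}, componentwise; e is given by its exponents.
_≥φ^_ : V4 → V4 → Set
v ≥φ^ e = (φ^ c0 e ≤ c0 v) × (φ^ c1 e ≤ c1 v) × (φ^ c2 e ≤ c2 v) × (φ^ c3 e ≤ c3 v)

Ψ : V4 → ℕ
Ψ e = 2 * (c1 e + c2 e + c3 e)

{-# OPTIONS --safe #-}
-- Writing 2 φ^e = L_e + F_e √5 (Lucas and Fibonacci numbers), the bound φ^e ≤ x
-- becomes an inequality between natural numbers, and such bounds multiply:
-- φ^e ≤ x and φ^f ≤ y give φ^(e+f) ≤ x y. Each coordinate of the Rule 3 root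
-- vector dominates either of its two monomials, each a product of three child
-- coordinates; keeping a suitable one in each coordinate, the exponents in
-- coordinates 1–3 are a permutation of those of the children, so Ψ is additive.
module Submission where

open import Defs
open import Data.Maybe using (just)
open import Data.Nat using (_+_)
open import Data.Product using (Σ; _×_)
open import Relation.Binary.PropositionalEquality using (_≡_)

open import Data.Nat using (ℕ; suc; _*_; _∸_; _≤_; _≤?_)
open import Data.Nat.Properties
open import Data.Nat.Tactic.RingSolver using (solve-∀)
open import Data.Product using (_,_)
open import Relation.Binary.PropositionalEquality
  using (refl; sym; trans; cong; cong₂; subst; subst₂; module ≡-Reasoning)
open import Relation.Nullary using (yes; no; contradiction)

m*m≤n*n⇒m≤n : ∀ {m n} → m * m ≤ n * n → m ≤ n
m*m≤n*n⇒m≤n {m} {n} le with m ≤? n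
... | yes m≤n = m≤n
... | no  m≰n = contradiction le (<⇒≱ (*-mono-< (≰⇒> m≰n) (≰⇒> m≰n)))

-- q √5≤ a  encodes  q √5 ≤ a; a record, so that q and a can be inferred.
infix 4 _√5≤_
record _√5≤_ (q a : ℕ) : Set where
  constructor from-squares
  field
    to-squares : 5 * (q * q) ≤ a * a
open _√5≤_

√5≤-mono : ∀ {q a b} → q √5≤ a → a ≤ b → q √5≤ b
√5≤-mono (from-squares q≤a) a≤b = from-squares (≤-trans q≤a (*-mono-≤ a≤b a≤b))

√5≤-* : ∀ {q s a b} → q √5≤ a → s √5≤ b → 5 * (q * s) ≤ a * b
√5≤-* {q} {s} {a} {b} (from-squares q≤a) (from-squares s≤b) =
  m*m≤n*n⇒m≤n (subst₂ _≤_ (square-5 q s) (square a b) (*-mono-≤ q≤a s≤b))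
  where
  square-5 : ∀ q s → 5 * (q * q) * (5 * (s * s)) ≡ 5 * (q * s) * (5 * (q * s))
  square-5 = solve-∀
  square : ∀ a b → a * a * (b * b) ≡ a * b * (a * b)
  square = solve-∀

√5≤-*ˡ : ∀ p {q a} → q √5≤ a → p * q √5≤ p * a
√5≤-*ˡ p {q} {a} (from-squares q≤a) =
  from-squares (subst₂ _≤_ (rearrange-5 p q) (rearrange p a) (*-monoʳ-≤ (p * p) q≤a))
  where
  rearrange-5 : ∀ p q → p * p * (5 * (q * q)) ≡ 5 * (p * q * (p * q))
  rearrange-5 = solve-∀
  rearrange : ∀ p a → p * p * (a * a) ≡ p * a * (p * a)
  rearrange = solve-∀

√5≤-+ : ∀ {q s a b} → q √5≤ a → s √5≤ b → q + s √5≤ a + b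
√5≤-+ {q} {s} {a} {b} q≤a s≤b = from-squares (begin
  5 * ((q + s) * (q + s))                         ≡⟨ expand-5 q s ⟩
  5 * (q * q) + 5 * (s * s) + 2 * (5 * (q * s))   ≤⟨ +-mono-≤ (+-mono-≤ (to-squares q≤a) (to-squares s≤b))
                                                              (*-monoʳ-≤ 2 (√5≤-* q≤a s≤b)) ⟩
  a * a + b * b + 2 * (a * b)                     ≡⟨ expand a b ⟨
  (a + b) * (a + b)                               ∎)
  where
  open ≤-Reasoning
  expand-5 : ∀ q s → 5 * ((q + s) * (q + s)) ≡ 5 * (q * q) + 5 * (s * s) + 2 * (5 * (q * s))
  expand-5 = solve-∀
  expand : ∀ a b → (a + b) * (a + b) ≡ a * a + b * b + 2 * (a * b)
  expand = solve-∀

√5≤-halve : ∀ {q a} → 2 * q √5≤ 2 * a → q √5≤ a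
√5≤-halve {q} {a} (from-squares h) =
  from-squares (*-cancelˡ-≤ 4 (subst₂ _≤_ (quadruple-5 q) (quadruple a) h))
  where
  quadruple-5 : ∀ q → 5 * (2 * q * (2 * q)) ≡ 4 * (5 * (q * q))
  quadruple-5 = solve-∀
  quadruple : ∀ a → 2 * a * (2 * a) ≡ 4 * (a * a)
  quadruple = solve-∀

-- The rational and √5-parts of 2φ · 2φ^n = 2 · 2φ^(n+1) and of
-- 2φ^m · 2φ^n = 2 · 2φ^(m+n).
lucas-suc : ∀ n → lucas n + 5 * fib n ≡ 2 * lucas (suc n)
lucas-suc 0 = refl
lucas-suc 1 = refl
lucas-suc (suc (suc n)) = begin
  lucas (suc n) + lucas n + 5 * (fib (suc n) + fib n)          ≡⟨ regroup (lucas (suc n)) (lucas n) (fib (suc n)) (fib n) ⟩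
  (lucas (suc n) + 5 * fib (suc n)) + (lucas n + 5 * fib n)    ≡⟨ cong₂ _+_ (lucas-suc (suc n)) (lucas-suc n) ⟩
  2 * lucas (suc (suc n)) + 2 * lucas (suc n)                  ≡⟨ *-distribˡ-+ 2 (lucas (suc (suc n))) (lucas (suc n)) ⟨
  2 * lucas (suc (suc (suc n)))                                ∎
  where
  open ≡-Reasoning
  regroup : ∀ a b c d → a + b + 5 * (c + d) ≡ (a + 5 * c) + (b + 5 * d)
  regroup = solve-∀

fib-suc : ∀ n → fib n + lucas n ≡ 2 * fib (suc n)
fib-suc 0 = refl
fib-suc 1 = refl
fib-suc (suc (suc n)) = begin
  fib (suc n) + fib n + (lucas (suc n) + lucas n)              ≡⟨ regroup (fib (suc n)) (fib n) (lucas (suc n)) (lucas n) ⟩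
  (fib (suc n) + lucas (suc n)) + (fib n + lucas n)            ≡⟨ cong₂ _+_ (fib-suc (suc n)) (fib-suc n) ⟩
  2 * fib (suc (suc n)) + 2 * fib (suc n)                      ≡⟨ *-distribˡ-+ 2 (fib (suc (suc n))) (fib (suc n)) ⟨
  2 * fib (suc (suc (suc n)))                                  ∎
  where
  open ≡-Reasoning
  regroup : ∀ a b c d → a + b + (c + d) ≡ (a + c) + (b + d)
  regroup = solve-∀

lucas-+ : ∀ m n → lucas m * lucas n + 5 * (fib m * fib n) ≡ 2 * lucas (m + n)
lucas-+ 0 n = +-identityʳ (2 * lucas n)
lucas-+ 1 n = trans (cong₂ (λ a b → a + 5 * b) (*-identityˡ (lucas n)) (*-identityˡ (fib n))) (lucas-suc n)
lucas-+ (suc (suc m)) n = begin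
  (lucas (suc m) + lucas m) * lucas n + 5 * ((fib (suc m) + fib m) * fib n)
    ≡⟨ distrib (lucas (suc m)) (lucas m) (fib (suc m)) (fib m) (lucas n) (fib n) ⟩
  (lucas (suc m) * lucas n + 5 * (fib (suc m) * fib n)) + (lucas m * lucas n + 5 * (fib m * fib n))
    ≡⟨ cong₂ _+_ (lucas-+ (suc m) n) (lucas-+ m n) ⟩
  2 * lucas (suc m + n) + 2 * lucas (m + n)
    ≡⟨ *-distribˡ-+ 2 (lucas (suc m + n)) (lucas (m + n)) ⟨
  2 * lucas (suc (suc m) + n)
    ∎
  where
  open ≡-Reasoning
  distrib : ∀ a b c d x y → (a + b) * x + 5 * ((c + d) * y) ≡ (a * x + 5 * (c * y)) + (b * x + 5 * (d * y))
  distrib = solve-∀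

fib-+ : ∀ m n → lucas m * fib n + lucas n * fib m ≡ 2 * fib (m + n)
fib-+ 0 n = trans (cong (2 * fib n +_) (*-zeroʳ (lucas n))) (+-identityʳ (2 * fib n))
fib-+ 1 n = trans (cong₂ _+_ (*-identityˡ (fib n)) (*-identityʳ (lucas n))) (fib-suc n)
fib-+ (suc (suc m)) n = begin
  (lucas (suc m) + lucas m) * fib n + lucas n * (fib (suc m) + fib m)
    ≡⟨ distrib (lucas (suc m)) (lucas m) (fib (suc m)) (fib m) (fib n) (lucas n) ⟩
  (lucas (suc m) * fib n + lucas n * fib (suc m)) + (lucas m * fib n + lucas n * fib m)
    ≡⟨ cong₂ _+_ (fib-+ (suc m) n) (fib-+ m n) ⟩
  2 * fib (suc m + n) + 2 * fib (m + n)
    ≡⟨ *-distribˡ-+ 2 (fib (suc m + n)) (fib (m + n)) ⟨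
  2 * fib (suc (suc m) + n)
    ∎
  where
  open ≡-Reasoning
  distrib : ∀ a b c d y x → (a + b) * y + x * (c + d) ≡ (a * y + x * c) + (b * y + x * d)
  distrib = solve-∀

φ^≤-intro : ∀ {e x a} → lucas e + a ≡ 2 * x → fib e √5≤ a → φ^ e ≤ x
φ^≤-intro {e} {x} {a} L+a≡2x F≤a =
  subst (lucas e ≤_) L+a≡2x (m≤m+n (lucas e) a) ,
  to-squares (subst (fib e √5≤_) (trans (sym (m+n∸m≡n (lucas e) a)) (cong (_∸ lucas e) L+a≡2x)) F≤a)

φ^≤-mono : ∀ {e x y} → φ^ e ≤ x → x ≤ y → φ^ e ≤ y
φ^≤-mono {e} {x} {y} (L≤2x , F≤2x-L) x≤y =
  ≤-trans L≤2x 2x≤2y , to-squares (√5≤-mono {fib e} (from-squares F≤2x-L) (∸-monoˡ-≤ (lucas e) 2x≤2y))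
  where
  2x≤2y : 2 * x ≤ 2 * y
  2x≤2y = *-monoʳ-≤ 2 x≤y

φ^≤-halve : ∀ {e z r} → 2 * lucas e + r ≡ 2 * (2 * z) → 2 * fib e √5≤ r → φ^ e ≤ z
φ^≤-halve {e} {z} {r} 2L+r≡4z 2F≤r =
  φ^≤-intro {e} {z} L+c≡2z (√5≤-halve (subst (2 * fib e √5≤_) r≡2c 2F≤r))
  where
  c = 2 * z ∸ lucas e
  L+c≡2z : lucas e + c ≡ 2 * z
  L+c≡2z = m+[n∸m]≡n (*-cancelˡ-≤ {lucas e} {2 * z} 2
    (subst (2 * lucas e ≤_) 2L+r≡4z (m≤m+n (2 * lucas e) r)))
  r≡2c : r ≡ 2 * c
  r≡2c = +-cancelˡ-≡ (2 * lucas e) r (2 * c)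
    (trans 2L+r≡4z (trans (cong (2 *_) (sym L+c≡2z)) (*-distribˡ-+ 2 (lucas e) c)))

φ^≤-* : ∀ {m n x y} → φ^ m ≤ x → φ^ n ≤ y → φ^ (m + n) ≤ (x * y)
φ^≤-* {m} {n} {x} {y} (p≤2x , q≤a) (r≤2y , s≤b) =
  φ^≤-halve {m + n} {x * y} product irrational-part
  where
  p = lucas m ; q = fib m ; r = lucas n ; s = fib n
  a = 2 * x ∸ p ; b = 2 * y ∸ r
  q√5≤a : q √5≤ a
  q√5≤a = from-squares q≤a
  s√5≤b : s √5≤ b
  s√5≤b = from-squares s≤b
  d = a * b ∸ 5 * (q * s)
  ab≡5qs+d : a * b ≡ 5 * (q * s) + d
  ab≡5qs+d = sym (m+[n∸m]≡n (√5≤-* q√5≤a s√5≤b))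
  product : 2 * lucas (m + n) + (p * b + r * a + d) ≡ 2 * (2 * (x * y))
  product = begin
    2 * lucas (m + n) + (p * b + r * a + d)      ≡⟨ cong (_+ (p * b + r * a + d)) (lucas-+ m n) ⟨
    p * r + 5 * (q * s) + (p * b + r * a + d)    ≡⟨ regroup p r a b (5 * (q * s)) d ⟩
    p * r + p * b + r * a + (5 * (q * s) + d)    ≡⟨ cong (p * r + p * b + r * a +_) ab≡5qs+d ⟨
    p * r + p * b + r * a + a * b                ≡⟨ expand p r a b ⟨
    (p + a) * (r + b)                            ≡⟨ cong₂ _*_ (m+[n∸m]≡n p≤2x) (m+[n∸m]≡n r≤2y) ⟩
    2 * x * (2 * y)                              ≡⟨ double-double x y ⟩
    2 * (2 * (x * y))                            ∎
    where
    open ≡-Reasoning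
    regroup : ∀ p r a b t d → p * r + t + (p * b + r * a + d) ≡ p * r + p * b + r * a + (t + d)
    regroup = solve-∀
    expand : ∀ p r a b → (p + a) * (r + b) ≡ p * r + p * b + r * a + a * b
    expand = solve-∀
    double-double : ∀ x y → 2 * x * (2 * y) ≡ 2 * (2 * (x * y))
    double-double = solve-∀
  irrational-part : 2 * fib (m + n) √5≤ p * b + r * a + d
  irrational-part = subst (_√5≤ p * b + r * a + d) (fib-+ m n)
    (√5≤-mono (√5≤-+ (√5≤-*ˡ p s√5≤b) (√5≤-*ˡ r q√5≤a)) (m≤m+n (p * b + r * a) d))

φ^≤-*₃-mono : ∀ e f g x y z {w} → φ^ e ≤ x → φ^ f ≤ y → φ^ g ≤ z → x * y * z ≤ w → φ^ (e + f + g) ≤ w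
φ^≤-*₃-mono e f g x y z {w} e≤x f≤y g≤z xyz≤w =
  φ^≤-mono {e + f + g} {x * y * z} {w}
    (φ^≤-* {e + f} {g} {x * y} {z} (φ^≤-* {e} {f} {x} {y} e≤x f≤y) g≤z) xyz≤w

-- In each coordinate of Rule 3 keep the monomial a₀b₀c₀, a₁b₃c₂, a₃b₂c₁, a₂b₁c₃ respectively.
rule3-exponents : V4 → V4 → V4 → V4
rule3-exponents a b c =
  ⟨ c0 a + c0 b + c0 c , c1 a + c3 b + c2 c , c3 a + c2 b + c1 c , c2 a + c1 b + c3 c ⟩

Ψ-rule3-exponents : ∀ a b c → Ψ (rule3-exponents a b c) ≡ Ψ a + Ψ b + Ψ c
Ψ-rule3-exponents ⟨ _ , a1 , a2 , a3 ⟩ ⟨ _ , b1 , b2 , b3 ⟩ ⟨ _ , c1 , c2 , c3 ⟩ =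
  permute a1 a2 a3 b1 b2 b3 c1 c2 c3
  where
  permute : ∀ a1 a2 a3 b1 b2 b3 c1 c2 c3 →
    2 * ((a1 + b3 + c2) + (a3 + b2 + c1) + (a2 + b1 + c3)) ≡
    2 * (a1 + a2 + a3) + 2 * (b1 + b2 + b3) + 2 * (c1 + c2 + c3)
  permute = solve-∀

lemma20 : (tw tu tz : Tree) (ew eu ez : V4) →
          rootVec tw ≥φ^ ew → rootVec tu ≥φ^ eu → rootVec tz ≥φ^ ez →
          Σ V4 (λ e → (rootVec (node (just tw) (just tu) (just tz)) ≥φ^ e)
                      × (Ψ e ≡ Ψ ew + Ψ eu + Ψ ez))
lemma20 tw tu tz ew eu ez (w0 , w1 , w2 , w3) (u0 , u1 , u2 , u3) (z0 , z1 , z2 , z3) =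
  rule3-exponents ew eu ez ,
  ( φ^≤-*₃-mono (c0 ew) (c0 eu) (c0 ez) (c0 a) (c0 b) (c0 c) w0 u0 z0 (m≤m+n (c0 a * c0 b * c0 c) (c1 a * c1 b * c1 c))
  , φ^≤-*₃-mono (c1 ew) (c3 eu) (c2 ez) (c1 a) (c3 b) (c2 c) w1 u3 z2 (m≤n+m (c1 a * c3 b * c2 c) (c0 a * c2 b * c3 c))
  , φ^≤-*₃-mono (c3 ew) (c2 eu) (c1 ez) (c3 a) (c2 b) (c1 c) w3 u2 z1 (m≤n+m (c3 a * c2 b * c1 c) (c2 a * c3 b * c0 c))
  , φ^≤-*₃-mono (c2 ew) (c1 eu) (c3 ez) (c2 a) (c1 b) (c3 c) w2 u1 z3 (m≤m+n (c2 a * c1 b * c3 c) (c3 a * c0 b * c2 c)) ) ,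
  Ψ-rule3-exponents ew eu ez
  where
  a = rootVec tw ; b = rootVec tu ; c = rootVec tz
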